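{- Let $p$ be a prime and let $\Gamma=\Gamma(D_{2p^2})$ be the intersection graph of $D_{2p^2}$, with vertex sets $H_i$, $H_p^i$, $H_{1,p}$ as in the context. Then for a vertex $v$, $\operatorname{ecc}(v)=2$ if $v\in H_{1,p}$ or $v=H_p^i$ for some $i$, and $\operatorname{ecc}(v)=3$ if $v\in H_i$ for some $i\in\{1,\dots,p\}$.
   Context: $D_{2n}=\langle r,s : r^n=s^2=1,\ srs=r^{ -1}\rangle$ is the dihedral group of order $2n$. The intersection graph $\Gamma(G)$ of a finite group $G$ has as vertices the proper non-trivial subgroups of $G$, two distinct vertices being adjacent iff their intersection is non-trivial. For $n=p^2$ the vertex set of $\Gamma(D_{2p^2})$ is the disjoint union of $H_i=\{\langle sr^{i+lp}\rangle : 1\le l\le p\}$ ($i=1,\dots,p$), the subgroups $H_p^i=\langle r^p, sr^i\rangle$ ($i=1,\dots,p$), and $H_{1,p}=\{\langle r\rangle,\langle r^p\rangle\}$. The eccentricity $\operatorname{ecc}(v)$ is the largest distance from $v$ to any other vertex. -}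

module Defs where

open import Data.Nat using (ℕ; zero; suc; _+_; _*_; _∸_; _<_; _≤_; NonZero)
open import Data.Nat.Base using (nonTrivial⇒nonZero)
open import Data.Nat.Properties using (m*n≢0)
open import Data.Nat.DivMod using (_mod_)
open import Data.Nat.Primality using (Prime; prime)
open import Data.Fin using (Fin; toℕ)
open import Data.Bool using (Bool; true; false; T; not)
open import Data.Product using (Σ; _×_; _,_; ∃; ∃-syntax)
open import Data.Sum using (_⊎_)
open import Data.List using (List; []; _∷_)
open import Data.List.Membership.Propositional using (_∈_)
open import Function.Bundles using (_⇔_)
open import Relation.Nullary using (¬_)
open import Relation.Binary.PropositionalEquality using (_≡_; _≢_)

-- An element is a pair (b , k) with k : Fin n (exponent of r mod n):
--   (false , k) represents r^k,   (true , k) represents s r^k.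

module Dihedral (n : ℕ) .{{nz : NonZero n}} where

  Elem : Set
  Elem = Bool × Fin n

  _⊕_ : Fin n → Fin n → Fin n
  a ⊕ b = (toℕ a + toℕ b) mod n

  ⊖_ : Fin n → Fin n
  ⊖ a = (n ∸ toℕ a) mod n

  -- group law:
  --   r^a · r^b = r^(a+b),      r^a · s r^b = s r^(b-a),
  --   s r^a · r^b = s r^(a+b),  s r^a · s r^b = r^(b-a)
  _·_ : Elem → Elem → Elem
  (false , a) · (false , b) = false , (a ⊕ b)
  (false , a) · (true  , b) = true  , (b ⊕ (⊖ a))
  (true  , a) · (false , b) = true  , (a ⊕ b)
  (true  , a) · (true  , b) = false , (b ⊕ (⊖ a))

  e : Elem
  e = false , (0 mod n)

  inv : Elem → Elem
  inv (false , a) = false , (⊖ a)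
  inv (true  , a) = true  , a

  rpow : ℕ → Elem
  rpow k = false , (k mod n)

  srpow : ℕ → Elem
  srpow k = true , (k mod n)

  Subset : Set
  Subset = Elem → Bool

  record IsSubgroup (H : Subset) : Set where
    field
      has-e   : T (H e)
      has-mul : ∀ x y → T (H x) → T (H y) → T (H (x · y))
      has-inv : ∀ x → T (H x) → T (H (inv x))

  _≐_ : Subset → Subset → Set
  H ≐ K = ∀ x → H x ≡ K x

  Proper : Subset → Set
  Proper H = ∃[ x ] H x ≡ false

  NonTrivialSub : Subset → Set
  NonTrivialSub H = ∃[ x ] (x ≢ e × H x ≡ true)

  record Vertex : Set where
    constructor vertex
    field
      set        : Subset
      subgroup   : IsSubgroup set
      proper     : Proper set
      nontrivial : NonTrivialSub set
  open Vertex public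

  Adj : Vertex → Vertex → Set
  Adj v w = ¬ (set v ≐ set w) × (∃[ x ] (x ≢ e × set v x ≡ true × set w x ≡ true))

  data Walk : Vertex → Vertex → ℕ → Set where
    here : ∀ {v w} → set v ≐ set w → Walk v w zero
    step : ∀ {u v w d} → Adj u v → Walk v w d → Walk u w (suc d)

  Dist : Vertex → Vertex → ℕ → Set
  Dist v w d = Walk v w d × (∀ d′ → d′ < d → ¬ Walk v w d′)

  Ecc : Vertex → ℕ → Set
  Ecc v k = (∀ w → ∃[ d ] (d ≤ k × Dist v w d)) × (∃[ w ] Dist v w k)

  Generated : List Elem → Elem → Set
  Generated gs x = ∀ (K : Subset) → IsSubgroup K → (∀ g → g ∈ gs → T (K g)) → T (K x)

  Is⟨_⟩ : List Elem → Vertex → Set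
  Is⟨ gs ⟩ v = ∀ x → (T (set v x) ⇔ Generated gs x)

primeSqNZ : ∀ {p} → Prime p → NonZero (p * p)
primeSqNZ {p} (prime _) = m*n≢0 p p
  where instance _ = nonTrivial⇒nonZero p

module DihSq (p : ℕ) (pr : Prime p) where
  open Dihedral (p * p) {{primeSqNZ pr}} public

  InH : ℕ → Vertex → Set
  InH i v = ∃[ l ] (1 ≤ l × l ≤ p × Is⟨ srpow (i + l * p) ∷ [] ⟩ v)

  IsHp : ℕ → Vertex → Set
  IsHp i v = Is⟨ rpow p ∷ srpow i ∷ [] ⟩ v

  InH1p : Vertex → Set
  InH1p v = Is⟨ rpow 1 ∷ [] ⟩ v ⊎ Is⟨ rpow p ∷ [] ⟩ v

-- Write H_d^t = ⟨ r^d , s r^t ⟩ for a divisor 1 < d < n of n (the paper's H_p^t, with d = p and n = p²).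
-- Every vertex contains a non-trivial rotation or a reflection s r^a, so it meets ⟨ r ⟩ or H_d^a, and both
-- contain r^d. Hence a vertex containing r^d is within distance 2 of every vertex, and ⟨ s r^k ⟩ ≤ H_d^k is
-- within distance 3. The bounds are attained at the reflection subgroups ⟨ s r^t ⟩, whose only non-trivial
-- element is s r^t: a vertex containing r^d but not s r^t is at distance exactly 2 from ⟨ s r^t ⟩, and
-- ⟨ s r^k ⟩ is at distance exactly 3 from ⟨ s r^(k+1) ⟩, because a common neighbour would contain
-- s r^k · s r^(k+1) = r and s r^k, hence the whole group. Distances exist since Γ is finite, so walks of
-- each length are decidable.

module Submission where

open import Defs
open import Data.Bool using (true; false; T; not)
open import Data.Bool.Properties using (T-≡; T?; ¬-not) renaming (_≟_ to _≟ᴮ_)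
open import Data.Empty using (⊥; ⊥-elim)
open import Data.Fin using (Fin; toℕ)
open import Data.Fin.Properties using (toℕ-injective; toℕ-fromℕ<; toℕ<n; all?; any?) renaming (_≟_ to _≟ᶠ_)
open import Data.Fin.Subset.Properties using (anySubset?)
open import Data.List using ([]; _∷_)
open import Data.List.Membership.Propositional using (_∈_)
open import Data.List.Relation.Unary.Any using (here; there)
open import Data.Nat using (ℕ; zero; suc; _+_; _*_; _∸_; _%_; _≡ᵇ_; _≤_; _<_; NonZero; z≤n; s≤s)
open import Data.Nat.Base using (nonTrivial⇒n>1; nonTrivial⇒nonZero)
open import Data.Nat.DivMod using (_mod_; %-distribˡ-+; m%n%n≡m%n; m%n<n; m%n≤n; m<n⇒m%n≡m; n%n≡0; m*n%n≡0; m∣n⇒o%n%m≡o%m)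
open import Data.Nat.Divisibility using (_∣_; ∣-refl; n∣m⇒m%n≡0; m∣m*n)
open import Data.Nat.Primality using (Prime; prime)
open import Data.Nat.Properties using (≡ᵇ⇒≡; ≡⇒≡ᵇ; +-assoc; +-identityʳ; +-mono-≤; m+[n∸m]≡n; m≤n⇒m<n∨m≡n; m<1+n⇒m<n∨m≡n; <-irrefl; <-trans; n<1+n; ≤-refl; ≤-trans; ≤-pred; <⇒≤; m<n⇒m<1+n; m<m*n)
open import Data.Product using (Σ; ∃; _×_; _,_; proj₁; proj₂; ∃-syntax)
open import Data.Product.Properties using (≡-dec)
open import Data.Sum using (_⊎_; inj₁; inj₂)
open import Data.Unit using (tt)
open import Data.Vec using (lookup; tabulate)
open import Data.Vec.Properties using (lookup∘tabulate)
open import Function using (_∘_)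
open import Function.Bundles using (Equivalence)
open import Relation.Binary using (DecidableEquality)
open import Relation.Binary.PropositionalEquality using (_≡_; _≢_; refl; sym; trans; cong; cong₂; subst; module ≡-Reasoning)
open import Relation.Nullary using (¬_; Dec; yes; no; ¬?; _×-dec_; _→-dec_)
open import Relation.Nullary.Decidable using (map′)
open import Relation.Unary as U using ()

open ≡-Reasoning

T⇒≡true : ∀ {b} → T b → b ≡ true
T⇒≡true = Equivalence.to T-≡

≡true⇒T : ∀ {b} → b ≡ true → T b
≡true⇒T = Equivalence.from T-≡

%-cong-+ : ∀ {m x x′ y y′} .{{_ : NonZero m}} →
           x % m ≡ x′ % m → y % m ≡ y′ % m → (x + y) % m ≡ (x′ + y′) % m
%-cong-+ {m} {x} {x′} {y} {y′} x≈x′ y≈y′ = begin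
  (x + y) % m           ≡⟨ %-distribˡ-+ x y m ⟩
  (x % m + y % m) % m   ≡⟨ cong₂ (λ a b → (a + b) % m) x≈x′ y≈y′ ⟩
  (x′ % m + y′ % m) % m ≡⟨ %-distribˡ-+ x′ y′ m ⟨
  (x′ + y′) % m         ∎

0%n≡0 : ∀ n .{{_ : NonZero n}} → 0 % n ≡ 0
0%n≡0 n = m*n%n≡0 0 n

m%n≢[1+m]%n : ∀ m {n} .{{_ : NonZero n}} → 1 < n → m % n ≢ suc m % n
m%n≢[1+m]%n m {n} 1<n eq = impossible (m≤n⇒m<n∨m≡n (m%n<n m n))
  where
  1+m≈1+r : suc m % n ≡ suc (m % n) % n
  1+m≈1+r = %-cong-+ {x = 1} refl (sym (m%n%n≡m%n m n))
  impossible : suc (m % n) < n ⊎ suc (m % n) ≡ n → ⊥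
  impossible (inj₁ 1+r<n) = <-irrefl (trans eq (trans 1+m≈1+r (m<n⇒m%n≡m 1+r<n))) (n<1+n _)
  impossible (inj₂ 1+r≡n) = <-irrefl (trans (cong suc (sym r≡0)) 1+r≡n) 1<n
    where
    r≡0 : m % n ≡ 0
    r≡0 = trans eq (trans 1+m≈1+r (trans (cong (_% n) 1+r≡n) (n%n≡0 n)))

module _ {P : ℕ → Set} (P? : U.Decidable P) where

  private
    search : ∀ n → (∀ k → k < n → ¬ P k) ⊎ ∃[ m ] (m < n × P m × (∀ k → k < m → ¬ P k))
    search zero = inj₁ λ _ ()
    search (suc n) with search n
    ... | inj₂ (m , m<n , pm , below) = inj₂ (m , m<n⇒m<1+n m<n , pm , below)
    ... | inj₁ none with P? n
    ...   | yes pn = inj₂ (n , ≤-refl , pn , none)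
    ...   | no ¬pn = inj₁ λ k k<1+n → case k k<1+n
      where
      case : ∀ k → k < suc n → ¬ P k
      case k k<1+n with m<1+n⇒m<n∨m≡n k<1+n
      ... | inj₁ k<n = none k k<n
      ... | inj₂ refl = ¬pn

  least-witness : ∀ {n} → P n → ∃[ m ] (m ≤ n × P m × (∀ k → k < m → ¬ P k))
  least-witness {n} pn with search (suc n)
  ... | inj₁ none = ⊥-elim (none n ≤-refl pn)
  ... | inj₂ (m , m<1+n , pm , below) = m , ≤-pred m<1+n , pm , below

module Subgroups (n : ℕ) .{{_ : NonZero n}} where
  open Dihedral n

  module Residue {d : ℕ} .{{_ : NonZero d}} (d∣n : d ∣ n) where

    infix 4 _≈_
    _≈_ : Fin n → ℕ → Set
    a ≈ m = toℕ a % d ≡ m % d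

    mod-≈ : ∀ m → m mod n ≈ m
    mod-≈ m = trans (cong (_% d) (toℕ-fromℕ< (m%n<n m n))) (m∣n⇒o%n%m≡o%m d n m d∣n)

    ⊕-≈ : ∀ {a b i j} → a ≈ i → b ≈ j → a ⊕ b ≈ i + j
    ⊕-≈ a≈i b≈j = trans (mod-≈ _) (%-cong-+ a≈i b≈j)

    ⊕-⊖-≈ : ∀ a → a ⊕ (⊖ a) ≈ 0
    ⊕-⊖-≈ a = begin
      toℕ (a ⊕ (⊖ a)) % d       ≡⟨ ⊕-≈ refl (mod-≈ (n ∸ toℕ a)) ⟩
      (toℕ a + (n ∸ toℕ a)) % d ≡⟨ cong (_% d) (m+[n∸m]≡n (<⇒≤ (toℕ<n a))) ⟩
      n % d                     ≡⟨ n∣m⇒m%n≡0 n d d∣n ⟩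
      0                         ≡⟨ 0%n≡0 d ⟨
      0 % d                     ∎

    ⊖-≈ : ∀ {a b i j} → a ≈ i → b ≈ j + i → b ⊕ (⊖ a) ≈ j
    ⊖-≈ {a} {b} {i} {j} a≈i b≈j+i = begin
      toℕ (b ⊕ (⊖ a)) % d           ≡⟨ ⊕-≈ b≈j+i refl ⟩
      (j + i + toℕ (⊖ a)) % d       ≡⟨ cong (_% d) (+-assoc j i _) ⟩
      (j + (i + toℕ (⊖ a))) % d     ≡⟨ %-cong-+ {x = j} refl (%-cong-+ (sym a≈i) refl) ⟩
      (j + (toℕ a + toℕ (⊖ a))) % d ≡⟨ %-cong-+ {x = j} refl (trans (sym (mod-≈ _)) (⊕-⊖-≈ a)) ⟩
      (j + 0) % d                   ≡⟨ cong (_% d) (+-identityʳ j) ⟩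
      j % d                         ∎

    ⊖-≈0 : ∀ {a} → a ≈ 0 → ⊖ a ≈ 0
    ⊖-≈0 {a} a≈0 = trans (%-cong-+ (sym a≈0) refl) (trans (sym (mod-≈ _)) (⊕-⊖-≈ a))

    -- H_d^t; for d = n this is ⟨ s r^t ⟩.
    residue : ℕ → Subset
    residue t (false , a) = toℕ a % d ≡ᵇ 0 % d
    residue t (true  , a) = toℕ a % d ≡ᵇ t % d

    residue-isSubgroup : ∀ t → IsSubgroup (residue t)
    residue-isSubgroup t = record { has-e = ≈⇒∈ (mod-≈ 0) ; has-mul = mul ; has-inv = inv′ }
      where
      ≈⇒∈ : ∀ {a m} → a ≈ m → T (toℕ a % d ≡ᵇ m % d)
      ≈⇒∈ = ≡⇒≡ᵇ _ _
      ∈⇒≈ : ∀ {a m} → T (toℕ a % d ≡ᵇ m % d) → a ≈ m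
      ∈⇒≈ = ≡ᵇ⇒≡ _ _
      t+0≡t : ∀ {a} → a ≈ t + 0 → a ≈ t
      t+0≡t a≈t+0 = trans a≈t+0 (cong (_% d) (+-identityʳ t))
      mul : ∀ x y → T (residue t x) → T (residue t y) → T (residue t (x · y))
      mul (false , a) (false , b) a∈ b∈ = ≈⇒∈ (⊕-≈ (∈⇒≈ a∈) (∈⇒≈ b∈))
      mul (false , a) (true  , b) a∈ b∈ =
        ≈⇒∈ (⊖-≈ (∈⇒≈ a∈) (trans (∈⇒≈ b∈) (cong (_% d) (sym (+-identityʳ t)))))
      mul (true  , a) (false , b) a∈ b∈ = ≈⇒∈ (t+0≡t (⊕-≈ (∈⇒≈ a∈) (∈⇒≈ b∈)))
      mul (true  , a) (true  , b) a∈ b∈ = ≈⇒∈ (⊖-≈ (∈⇒≈ a∈) (∈⇒≈ b∈))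
      inv′ : ∀ x → T (residue t x) → T (residue t (inv x))
      inv′ (false , a) a∈ = ≈⇒∈ (⊖-≈0 (∈⇒≈ a∈))
      inv′ (true  , a) a∈ = a∈

    srpow∈residue : ∀ t → residue t (srpow t) ≡ true
    srpow∈residue t = T⇒≡true (≡⇒≡ᵇ _ _ (mod-≈ t))

    rpow-d∈residue : ∀ t → residue t (rpow d) ≡ true
    rpow-d∈residue t = T⇒≡true (≡⇒≡ᵇ _ _ (trans (mod-≈ d) (trans (n%n≡0 d) (sym (0%n≡0 d)))))

    residue-srpow : ∀ {t k} → residue t (srpow k) ≡ true → k % d ≡ t % d
    residue-srpow k∈ = trans (sym (mod-≈ _)) (≡ᵇ⇒≡ _ _ (≡true⇒T k∈))

    rpow1∉residue : 1 < d → ∀ t → residue t (rpow 1) ≢ true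
    rpow1∉residue 1<d t r∈ with trans (sym (m<n⇒m%n≡m 1<d))
                                 (trans (sym (mod-≈ 1)) (trans (≡ᵇ⇒≡ _ _ (≡true⇒T r∈)) (0%n≡0 d)))
    ... | ()

    residueᵛ : 1 < d → ℕ → Vertex
    residueᵛ 1<d t = vertex (residue t) (residue-isSubgroup t)
                            (rpow 1 , ¬-not (rpow1∉residue 1<d t)) (srpow t , (λ ()) , srpow∈residue t)

  module Rₙ = Residue (∣-refl {n})

  ≈ₙ⇒≡ : ∀ {a m} → a Rₙ.≈ m → a ≡ m mod n
  ≈ₙ⇒≡ {a} {m} a≈m =
    toℕ-injective (trans (sym (m<n⇒m%n≡m (toℕ<n a))) (trans a≈m (sym (toℕ-fromℕ< (m%n<n m n)))))

  rotation≢reflection : ∀ {a b} → _≢_ {A = Elem} (false , a) (true , b)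
  rotation≢reflection ()

  rpow≢e : ∀ {m} → 0 < m → m < n → rpow m ≢ e
  rpow≢e {m} 0<m m<n rᵐ≡e = <-irrefl (sym m≡0) 0<m
    where
    m≡0 : m ≡ 0
    m≡0 = trans (sym (m<n⇒m%n≡m m<n))
                (trans (sym (toℕ-fromℕ< (m%n<n m n)))
                       (trans (cong (toℕ ∘ proj₂) rᵐ≡e) (trans (toℕ-fromℕ< (m%n<n 0 n)) (0%n≡0 n))))

  srpow≢srpow-suc : 1 < n → ∀ k → srpow k ≢ srpow (suc k)
  srpow≢srpow-suc 1<n k eq = m%n≢[1+m]%n k 1<n
    (trans (sym (Rₙ.mod-≈ k)) (trans (cong (λ x → toℕ (proj₂ x) % n) eq) (Rₙ.mod-≈ (suc k))))

  residueₙ-elements : ∀ t x → Rₙ.residue t x ≡ true → x ≢ e → x ≡ srpow t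
  residueₙ-elements t (false , a) x∈ x≢e =
    ⊥-elim (x≢e (cong (false ,_) (≈ₙ⇒≡ (≡ᵇ⇒≡ _ _ (≡true⇒T x∈)))))
  residueₙ-elements t (true , a) x∈ _ = cong (true ,_) (≈ₙ⇒≡ (≡ᵇ⇒≡ _ _ (≡true⇒T x∈)))

  rpow-suc : ∀ j → rpow 1 · rpow j ≡ rpow (suc j)
  rpow-suc j = cong (false ,_) (≈ₙ⇒≡ (Rₙ.⊕-≈ (Rₙ.mod-≈ 1) (Rₙ.mod-≈ j)))

  srpow-·-rpow : ∀ i j → srpow i · rpow j ≡ srpow (i + j)
  srpow-·-rpow i j = cong (true ,_) (≈ₙ⇒≡ (Rₙ.⊕-≈ (Rₙ.mod-≈ i) (Rₙ.mod-≈ j)))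

  srpow-·-srpow : ∀ i j → srpow i · srpow (j + i) ≡ rpow j
  srpow-·-srpow i j = cong (false ,_) (≈ₙ⇒≡ (Rₙ.⊖-≈ (Rₙ.mod-≈ i) (Rₙ.mod-≈ (j + i))))

  rotation≡rpow : ∀ a → (false , a) ≡ rpow (toℕ a)
  rotation≡rpow a = cong (false ,_) (≈ₙ⇒≡ refl)

  -- s r^a = s r^k · r^c  with  c = (n − k mod n) + a.
  reflection≡srpow : ∀ k a → (true , a) ≡ srpow (k + ((n ∸ k % n) + toℕ a))
  reflection≡srpow k a = cong (true ,_) (≈ₙ⇒≡ (sym (begin
    (k + (c + toℕ a)) % n ≡⟨ cong (_% n) (+-assoc k c (toℕ a)) ⟨
    (k + c + toℕ a) % n   ≡⟨ %-cong-+ k+c≈0 refl ⟩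
    toℕ a % n             ∎)))
    where
    c = n ∸ k % n
    k+c≈0 : (k + c) % n ≡ 0 % n
    k+c≈0 = begin
      (k + c) % n     ≡⟨ %-cong-+ (sym (m%n%n≡m%n k n)) refl ⟩
      (k % n + c) % n ≡⟨ cong (_% n) (m+[n∸m]≡n (m%n≤n k n)) ⟩
      n % n           ≡⟨ n%n≡0 n ⟩
      0               ≡⟨ 0%n≡0 n ⟨
      0 % n           ∎

  module _ {H : Subset} (H≤G : IsSubgroup H) where
    open IsSubgroup H≤G

    rpow∈ : T (H (rpow 1)) → ∀ j → T (H (rpow j))
    rpow∈ r∈H zero    = has-e
    rpow∈ r∈H (suc j) = subst (T ∘ H) (rpow-suc j) (has-mul _ _ r∈H (rpow∈ r∈H j))

    rpow-srpow-generate : ∀ {k} → T (H (rpow 1)) → T (H (srpow k)) → ∀ x → T (H x)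
    rpow-srpow-generate r∈H _ (false , a) = subst (T ∘ H) (sym (rotation≡rpow a)) (rpow∈ r∈H (toℕ a))
    rpow-srpow-generate {k} r∈H srᵏ∈H (true , a) =
      subst (T ∘ H) (trans (srpow-·-rpow k _) (sym (reflection≡srpow k a)))
                    (has-mul _ _ srᵏ∈H (rpow∈ r∈H _))

    consecutive-srpow-generate : ∀ {k} → T (H (srpow k)) → T (H (srpow (suc k))) → ∀ x → T (H x)
    consecutive-srpow-generate {k} srᵏ∈H srᵏ⁺¹∈H =
      rpow-srpow-generate (subst (T ∘ H) (srpow-·-srpow k 1) (has-mul _ _ srᵏ∈H srᵏ⁺¹∈H)) srᵏ∈H

  rotations : Subset
  rotations (b , _) = not b

  rotations-isSubgroup : IsSubgroup rotations
  rotations-isSubgroup = record { has-e = tt ; has-mul = mul ; has-inv = inv′ }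
    where
    mul : ∀ x y → T (rotations x) → T (rotations y) → T (rotations (x · y))
    mul (false , _) (false , _) _ _ = tt
    inv′ : ∀ x → T (rotations x) → T (rotations (inv x))
    inv′ (false , _) _ = tt

  infix 4 _∋_
  _∋_ : Vertex → Elem → Set
  v ∋ x = set v x ≡ true

  generated∈ : ∀ {gs v x} → Is⟨ gs ⟩ v → Generated gs x → v ∋ x
  generated∈ v≡⟨gs⟩ x∈⟨gs⟩ = T⇒≡true (Equivalence.from (v≡⟨gs⟩ _) x∈⟨gs⟩)

  generator∈ : ∀ {gs v g} → Is⟨ gs ⟩ v → g ∈ gs → v ∋ g
  generator∈ {v = v} v≡⟨gs⟩ g∈gs = generated∈ {v = v} v≡⟨gs⟩ (λ _ _ gs⊆K → gs⊆K _ g∈gs)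

  generated⊆ : ∀ {gs v K x} → Is⟨ gs ⟩ v → IsSubgroup K → (∀ g → g ∈ gs → T (K g)) → v ∋ x → T (K x)
  generated⊆ v≡⟨gs⟩ K≤G gs⊆K x∈v = Equivalence.to (v≡⟨gs⟩ _) (≡true⇒T x∈v) _ K≤G gs⊆K

  ReflectionOnly : ℕ → Vertex → Set
  ReflectionOnly k v = ∀ x → v ∋ x → x ≢ e → x ≡ srpow k

  residueₙ-reflectionOnly : ∀ {t v} → (∀ {x} → v ∋ x → Rₙ.residue t x ≡ true) → ReflectionOnly t v
  residueₙ-reflectionOnly {t} v⊆residue x v∋x = residueₙ-elements t x (v⊆residue v∋x)

  ⟨srpow⟩-reflectionOnly : ∀ {k v} → Is⟨ srpow k ∷ [] ⟩ v → ReflectionOnly k v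
  ⟨srpow⟩-reflectionOnly {k} {v} v≡⟨srᵏ⟩ = residueₙ-reflectionOnly {v = v} λ v∋x →
    T⇒≡true (generated⊆ {v = v} v≡⟨srᵏ⟩ (Rₙ.residue-isSubgroup k)
                        (λ { _ (here refl) → ≡true⇒T (Rₙ.srpow∈residue k) }) v∋x)

module Graph (n : ℕ) .{{_ : NonZero n}} where
  open Dihedral n
  open Subgroups n using (_∋_)

  private variable
    H K : Subset
    u u′ v w w′ : Vertex
    a b k : ℕ

  ≐-refl : H ≐ H
  ≐-refl _ = refl

  ≐-sym : H ≐ K → K ≐ H
  ≐-sym H≐K x = sym (H≐K x)

  ≐-trans : ∀ {L} → H ≐ K → K ≐ L → H ≐ L
  ≐-trans H≐K K≐L x = trans (H≐K x) (K≐L x)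

  data Meet (u w : Vertex) : Set where
    meet : ∀ x → x ≢ e → u ∋ x → w ∋ x → Meet u w

  meet-sym : Meet u w → Meet w u
  meet-sym (meet x x≢e u∋x w∋x) = meet x x≢e w∋x u∋x

  meet-respˡ : set u ≐ set u′ → Meet u w → Meet u′ w
  meet-respˡ u≐u′ (meet x x≢e u∋x w∋x) = meet x x≢e (trans (sym (u≐u′ x)) u∋x) w∋x

  meet-respʳ : set w ≐ set w′ → Meet u w → Meet u w′
  meet-respʳ w≐w′ (meet x x≢e u∋x w∋x) = meet x x≢e u∋x (trans (sym (w≐w′ x)) w∋x)

  adj⇒meet : ∀ {u w} → Adj u w → Meet u w
  adj⇒meet (_ , x , x≢e , u∋x , w∋x) = meet x x≢e u∋x w∋x

  distinct-meet⇒adj : ¬ set u ≐ set w → Meet u w → Adj u w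
  distinct-meet⇒adj u≠w (meet x x≢e u∋x w∋x) = u≠w , x , x≢e , u∋x , w∋x

  differ⇒adj : ∀ {u w x} → set u x ≢ set w x → Meet u w → Adj u w
  differ⇒adj differ = distinct-meet⇒adj (λ u≐w → differ (u≐w _))

  adj-respˡ : ∀ {u u′ w} → set u ≐ set u′ → Adj u w → Adj u′ w
  adj-respˡ {u} {u′} {w} u≐u′ u~w =
    distinct-meet⇒adj (λ u′≐w → proj₁ u~w (≐-trans u≐u′ u′≐w))
                      (meet-respˡ {u′ = u′} u≐u′ (adj⇒meet {u} {w} u~w))

  adj-respʳ : ∀ {u w w′} → set w ≐ set w′ → Adj u w → Adj u w′
  adj-respʳ {u} {w} {w′} w≐w′ u~w =
    distinct-meet⇒adj (λ u≐w′ → proj₁ u~w (≐-trans u≐w′ (≐-sym w≐w′)))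
                      (meet-respʳ {w′ = w′} w≐w′ (adj⇒meet {u} {w} u~w))

  walk-respˡ : ∀ {u u′ w d} → set u ≐ set u′ → Walk u w d → Walk u′ w d
  walk-respˡ u≐u′ (here u≐w)    = here (≐-trans (≐-sym u≐u′) u≐w)
  walk-respˡ {u} {u′} u≐u′ (step {v = v} u~v vw) = step (adj-respˡ {u} {u′} {v} u≐u′ u~v) vw

  _++ᵂ_ : ∀ {u v w a b} → Walk u v a → Walk v w b → Walk u w (a + b)
  _++ᵂ_ {u} {v} (here u≐v) vw = walk-respˡ {v} {u} (≐-sym u≐v) vw
  step u~x xv ++ᵂ vw          = step u~x (xv ++ᵂ vw)

  walk₁⇒meet : Walk u w 1 → Meet u w
  walk₁⇒meet (step {v = v} u~v (here v≐w)) = meet-respʳ v≐w (adj⇒meet {w = v} u~v)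

  ∀-Elem? : {P : Elem → Set} → U.Decidable P → Dec (∀ x → P x)
  ∀-Elem? P? with all? (P? ∘ (false ,_)) | all? (P? ∘ (true ,_))
  ... | yes ∀rot | yes ∀ref = yes λ { (false , a) → ∀rot a ; (true , a) → ∀ref a }
  ... | no ¬∀rot | _        = no λ ∀P → ¬∀rot (∀P ∘ (false ,_))
  ... | yes _    | no ¬∀ref = no λ ∀P → ¬∀ref (∀P ∘ (true ,_))

  ∃-Elem? : {P : Elem → Set} → U.Decidable P → Dec (∃ P)
  ∃-Elem? P? with any? (P? ∘ (false ,_)) | any? (P? ∘ (true ,_))
  ... | yes (a , pa) | _            = yes ((false , a) , pa)
  ... | no _         | yes (a , pa) = yes ((true , a) , pa)
  ... | no ¬∃rot     | no ¬∃ref     =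
    no λ { ((false , a) , pa) → ¬∃rot (a , pa) ; ((true , a) , pa) → ¬∃ref (a , pa) }

  _≟ᴱ_ : DecidableEquality Elem
  _≟ᴱ_ = ≡-dec _≟ᴮ_ _≟ᶠ_

  _≐?_ : ∀ H K → Dec (H ≐ K)
  H ≐? K = ∀-Elem? λ x → H x ≟ᴮ K x

  adj? : ∀ u w → Dec (Adj u w)
  adj? u w = ¬? (set u ≐? set w)
       ×-dec ∃-Elem? (λ x → ¬? (x ≟ᴱ e) ×-dec set u x ≟ᴮ true ×-dec set w x ≟ᴮ true)

  isSubgroup? : ∀ H → Dec (IsSubgroup H)
  isSubgroup? H = map′ (λ (e∈ , mul , inv∈) → record { has-e = e∈ ; has-mul = mul ; has-inv = inv∈ })
                       (λ H≤G → IsSubgroup.has-e H≤G , IsSubgroup.has-mul H≤G , IsSubgroup.has-inv H≤G)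
    (T? (H e)
     ×-dec ∀-Elem? (λ x → ∀-Elem? λ y → T? (H x) →-dec T? (H y) →-dec T? (H (x · y)))
     ×-dec ∀-Elem? (λ x → T? (H x) →-dec T? (H (inv x))))

  isSubgroup-resp : H ≐ K → IsSubgroup H → IsSubgroup K
  isSubgroup-resp H≐K H≤G = record
    { has-e   = subst T (H≐K e) has-e
    ; has-mul = λ x y x∈ y∈ →
        subst T (H≐K (x · y)) (has-mul x y (subst T (sym (H≐K x)) x∈) (subst T (sym (H≐K y)) y∈))
    ; has-inv = λ x x∈ → subst T (H≐K (inv x)) (has-inv x (subst T (sym (H≐K x)) x∈))
    }
    where open IsSubgroup H≤G

  -- Subsets of Elem, enumerated as pairs of subsets of Fin n (rotations, reflections).
  ∃-Subset? : {P : Subset → Set} → (∀ {H K} → H ≐ K → P H → P K) → U.Decidable P → Dec (∃ P)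
  ∃-Subset? {P} resp P? =
    map′ (λ (R , S , p) → fromParts R S , p)
         (λ (H , p) → _ , _ , resp (≐-sym (fromParts-tabulate H)) p)
         (anySubset? λ R → anySubset? λ S → P? (fromParts R S))
    where
    fromParts : _ → _ → Subset
    fromParts R S (false , a) = lookup R a
    fromParts R S (true  , a) = lookup S a
    fromParts-tabulate : ∀ H → fromParts (tabulate (H ∘ (false ,_))) (tabulate (H ∘ (true ,_))) ≐ H
    fromParts-tabulate H (false , a) = lookup∘tabulate _ a
    fromParts-tabulate H (true  , a) = lookup∘tabulate _ a

  ∃-Vertex? : {P : Vertex → Set} → (∀ {u u′} → set u ≐ set u′ → P u → P u′) → U.Decidable P → Dec (∃ P)
  ∃-Vertex? {P} resp P? =
    map′ (λ (H , H≤G , H≠G , H≠1 , p) → vertex H H≤G H≠G H≠1 , p)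
         (λ (vertex H H≤G H≠G H≠1 , p) → H , H≤G , H≠G , H≠1 , p)
         (∃-Subset? respᴴ P?ᴴ)
    where
    Pᴴ : Subset → Set
    Pᴴ H = Σ (IsSubgroup H) λ H≤G → Σ (Proper H) λ H≠G → Σ (NonTrivialSub H) λ H≠1 →
           P (vertex H H≤G H≠G H≠1)
    respᴴ : H ≐ K → Pᴴ H → Pᴴ K
    respᴴ H≐K (H≤G , (x , x∉H) , (y , y≢e , y∈H) , p) =
      isSubgroup-resp H≐K H≤G , (x , trans (sym (H≐K x)) x∉H) , (y , y≢e , trans (sym (H≐K y)) y∈H) ,
      resp H≐K p
    P?ᴴ : U.Decidable Pᴴ
    P?ᴴ H with isSubgroup? H
             | ∃-Elem? (λ x → H x ≟ᴮ false)
             | ∃-Elem? (λ x → ¬? (x ≟ᴱ e) ×-dec H x ≟ᴮ true)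
    ... | no ¬H≤G | _       | _       = no λ (H≤G , _) → ¬H≤G H≤G
    ... | yes _   | no ¬H≠G | _       = no λ (_ , H≠G , _) → ¬H≠G H≠G
    ... | yes _   | yes _   | no ¬H≠1 = no λ (_ , _ , H≠1 , _) → ¬H≠1 H≠1
    ... | yes H≤G | yes H≠G | yes H≠1 with P? (vertex H H≤G H≠G H≠1)
    ...   | yes p  = yes (H≤G , H≠G , H≠1 , p)
    ...   | no ¬p  = no λ (_ , _ , _ , p) → ¬p (resp ≐-refl p)

  walk? : ∀ d u w → Dec (Walk u w d)
  walk? zero    u w = map′ here (λ { (here u≐w) → u≐w }) (set u ≐? set w)
  walk? (suc d) u w =
    map′ (λ (v , u~v , vw) → step u~v vw) (λ { (step u~v vw) → _ , u~v , vw })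
         (∃-Vertex? (λ {v} {v′} v≐v′ (u~v , vw) →
                       adj-respʳ {u} {v} {v′} v≐v′ u~v , walk-respˡ {v} {v′} v≐v′ vw)
                    (λ v → adj? u v ×-dec walk? d v w))

  Within : Vertex → Vertex → ℕ → Set
  Within u w k = ∃[ d ] (d ≤ k × Walk u w d)

  meet⇒within₁ : Meet u w → Within u w 1
  meet⇒within₁ {u} {w} u~w with set u ≐? set w
  ... | yes u≐w = 0 , z≤n , here u≐w
  ... | no  u≠w = 1 , ≤-refl , step {v = w} (distinct-meet⇒adj u≠w u~w) (here ≐-refl)

  within-trans : Within u v a → Within v w b → Within u w (a + b)
  within-trans (d₁ , d₁≤a , uv) (d₂ , d₂≤b , vw) = d₁ + d₂ , +-mono-≤ d₁≤a d₂≤b , uv ++ᵂ vw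

  within⇒dist : Within u w k → ∃[ d ] (d ≤ k × Dist u w d)
  within⇒dist {u} {w} (d , d≤k , uw) with least-witness (λ m → walk? m u w) uw
  ... | m , m≤d , uw′ , no-shorter = m , ≤-trans m≤d d≤k , uw′ , no-shorter

module Eccentricity (n d : ℕ) .{{_ : NonZero n}} .{{_ : NonZero d}}
                    (d∣n : d ∣ n) (1<d : 1 < d) (d<n : d < n) where
  open Dihedral n
  open Subgroups n
  open Residue d∣n
  open Graph n

  private
    1<n : 1 < n
    1<n = <-trans 1<d d<n

    rᵈ≢e : rpow d ≢ e
    rᵈ≢e = rpow≢e (<-trans (s≤s z≤n) 1<d) d<n

  ⟨r⟩ᵛ : Vertex
  ⟨r⟩ᵛ = vertex rotations rotations-isSubgroup (srpow 0 , refl) (rpow d , rᵈ≢e , refl)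

  Hᵛ : ℕ → Vertex
  Hᵛ = residueᵛ 1<d

  ⟨sr⟩ᵛ : ℕ → Vertex
  ⟨sr⟩ᵛ = Rₙ.residueᵛ 1<n

  ⟨sr⟩ᵛ-reflectionOnly : ∀ t → ReflectionOnly t (⟨sr⟩ᵛ t)
  ⟨sr⟩ᵛ-reflectionOnly t = residueₙ-reflectionOnly {v = ⟨sr⟩ᵛ t} (λ x∈ → x∈)

  meet-reflectionOnly : ∀ {k v u} → ReflectionOnly k v → Meet v u → u ∋ srpow k
  meet-reflectionOnly {u = u} only (meet x x≢e v∋x u∋x) = subst (u ∋_) (only x v∋x x≢e) u∋x

  rᵈ∉reflectionOnly : ∀ {k v} → ReflectionOnly k v → ¬ v ∋ rpow d
  rᵈ∉reflectionOnly only v∋rᵈ = rotation≢reflection (only _ v∋rᵈ rᵈ≢e)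

  srpow-suc∉residue : ∀ t → ¬ residue t (srpow (suc t)) ≡ true
  srpow-suc∉residue t sr∈ = m%n≢[1+m]%n t 1<d (sym (residue-srpow sr∈))

  ∋srpow-if-near-⟨sr⟩ᵛ : ∀ {v t d′} → d′ ≤ 1 → Walk v (⟨sr⟩ᵛ t) d′ → v ∋ srpow t
  ∋srpow-if-near-⟨sr⟩ᵛ {t = t} _ (here v≐) = trans (v≐ _) (Rₙ.srpow∈residue t)
  ∋srpow-if-near-⟨sr⟩ᵛ {t = t} (s≤s z≤n) walk@(step _ (here _)) =
    meet-reflectionOnly (⟨sr⟩ᵛ-reflectionOnly t) (meet-sym (walk₁⇒meet walk))

  Hᵛ-adj-⟨sr⟩ᵛ : ∀ t → Adj (Hᵛ t) (⟨sr⟩ᵛ t)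
  Hᵛ-adj-⟨sr⟩ᵛ t =
    differ⇒adj {Hᵛ t} {⟨sr⟩ᵛ t} {rpow d}
      (λ eq → rᵈ∉reflectionOnly {v = ⟨sr⟩ᵛ t} (⟨sr⟩ᵛ-reflectionOnly t) (trans (sym eq) (rpow-d∈residue t)))
               (meet (srpow t) (λ ()) (srpow∈residue t) (Rₙ.srpow∈residue t))

  meets-rᵈ-vertex : ∀ w → ∃[ u ] (u ∋ rpow d × Meet u w)
  meets-rᵈ-vertex w with nontrivial w
  ... | (false , a) , x≢e , w∋x = ⟨r⟩ᵛ , refl , meet _ x≢e refl w∋x
  ... | (true  , a) , x≢e , w∋x =
    Hᵛ (toℕ a) , rpow-d∈residue (toℕ a) , meet (true , a) x≢e (T⇒≡true (≡⇒≡ᵇ (toℕ a % d) _ refl)) w∋x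

  ∋rᵈ⇒within₂ : ∀ {v} → v ∋ rpow d → ∀ w → Within v w 2
  ∋rᵈ⇒within₂ v∋rᵈ w with meets-rᵈ-vertex w
  ... | u , u∋rᵈ , u~w = within-trans (meet⇒within₁ (meet (rpow d) rᵈ≢e v∋rᵈ u∋rᵈ)) (meet⇒within₁ u~w)

  ∋rᵈ⇒ecc≡2 : ∀ v t → v ∋ rpow d → ¬ v ∋ srpow t → Ecc v 2
  ∋rᵈ⇒ecc≡2 v t v∋rᵈ v∌srᵗ = (within⇒dist ∘ ∋rᵈ⇒within₂ v∋rᵈ) , ⟨sr⟩ᵛ t , walk , no-shorter
    where
    v-adj-Hᵗ : Adj v (Hᵛ t)
    v-adj-Hᵗ = differ⇒adj {v} {Hᵛ t} {srpow t} (λ eq → v∌srᵗ (trans eq (srpow∈residue t)))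
                          (meet (rpow d) rᵈ≢e v∋rᵈ (rpow-d∈residue t))
    walk : Walk v (⟨sr⟩ᵛ t) 2
    walk = step {v = Hᵛ t} v-adj-Hᵗ (step {v = ⟨sr⟩ᵛ t} (Hᵛ-adj-⟨sr⟩ᵛ t) (here ≐-refl))
    no-shorter : ∀ d′ → d′ < 2 → ¬ Walk v (⟨sr⟩ᵛ t) d′
    no-shorter d′ (s≤s d′≤1) walk = v∌srᵗ (∋srpow-if-near-⟨sr⟩ᵛ d′≤1 walk)

  reflectionOnly⇒ecc≡3 : ∀ v k → v ∋ srpow k → ReflectionOnly k v → Ecc v 3
  reflectionOnly⇒ecc≡3 v k v∋srᵏ only = within⇒dist ∘ within₃ , ⟨sr⟩ᵛ (suc k) , walk , no-shorter
    where
    v~Hᵏ : Meet v (Hᵛ k)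
    v~Hᵏ = meet (srpow k) (λ ()) v∋srᵏ (srpow∈residue k)
    within₃ : ∀ w → Within v w 3
    within₃ w = within-trans (meet⇒within₁ v~Hᵏ) (∋rᵈ⇒within₂ (rpow-d∈residue k) w)
    v-adj-Hᵏ : Adj v (Hᵛ k)
    v-adj-Hᵏ = differ⇒adj {x = rpow d} (λ eq → rᵈ∉reflectionOnly {v = v} only (trans eq (rpow-d∈residue k)))
                          v~Hᵏ
    Hᵏ-adj-Hᵏ⁺¹ : Adj (Hᵛ k) (Hᵛ (suc k))
    Hᵏ-adj-Hᵏ⁺¹ = differ⇒adj {Hᵛ k} {Hᵛ (suc k)} {srpow (suc k)}
                    (λ eq → srpow-suc∉residue k (trans eq (srpow∈residue (suc k))))
                    (meet (rpow d) rᵈ≢e (rpow-d∈residue k) (rpow-d∈residue (suc k)))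
    walk : Walk v (⟨sr⟩ᵛ (suc k)) 3
    walk = step {v = Hᵛ k} v-adj-Hᵏ
             (step {v = Hᵛ (suc k)} Hᵏ-adj-Hᵏ⁺¹
               (step {v = ⟨sr⟩ᵛ (suc k)} (Hᵛ-adj-⟨sr⟩ᵛ (suc k)) (here ≐-refl)))
    srᵏ⁺¹≢srᵏ : srpow (suc k) ≢ srpow k
    srᵏ⁺¹≢srᵏ = srpow≢srpow-suc 1<n k ∘ sym
    no-shorter : ∀ d′ → d′ < 3 → ¬ Walk v (⟨sr⟩ᵛ (suc k)) d′
    no-shorter 0 _ walk = srᵏ⁺¹≢srᵏ (only _ (∋srpow-if-near-⟨sr⟩ᵛ z≤n walk) (λ ()))
    no-shorter 1 _ walk = srᵏ⁺¹≢srᵏ (only _ (∋srpow-if-near-⟨sr⟩ᵛ (s≤s z≤n) walk) (λ ()))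
    no-shorter 2 _ (step {v = u} v~u (step {v = w} u~w (here w≐))) with proper u
    ... | z , u∌z =
      subst T u∌z (consecutive-srpow-generate (subgroup u) (≡true⇒T u∋srᵏ) (≡true⇒T u∋srᵏ⁺¹) z)
      where
      u∋srᵏ : u ∋ srpow k
      u∋srᵏ = meet-reflectionOnly only (adj⇒meet {v} {u} v~u)
      u∋srᵏ⁺¹ : u ∋ srpow (suc k)
      u∋srᵏ⁺¹ = meet-reflectionOnly {v = ⟨sr⟩ᵛ (suc k)} (⟨sr⟩ᵛ-reflectionOnly (suc k))
                                    (meet-sym (meet-respʳ w≐ (adj⇒meet {u} {w} u~w)))
    no-shorter (suc (suc (suc _))) (s≤s (s≤s (s≤s ())))

theorem2p11 : (p : ℕ) (pr : Prime p) (v : DihSq.Vertex p pr) →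
    ((DihSq.InH1p p pr v ⊎ (∃[ i ] (1 ≤ i × i ≤ p × DihSq.IsHp p pr i v))) → DihSq.Ecc p pr v 2)
    × ((∃[ i ] (1 ≤ i × i ≤ p × DihSq.InH p pr i v)) → DihSq.Ecc p pr v 3)
theorem2p11 p pr@(prime {{p-nontrivial}} _) v = ecc≡2 , ecc≡3
  where
  open DihSq p pr
  instance
    _ = nonTrivial⇒nonZero p
    _ = primeSqNZ pr
  open Subgroups (p * p)
  open Residue {p} (m∣m*n p)
  open Eccentricity (p * p) p (m∣m*n p) (nonTrivial⇒n>1 p) (m<m*n p p (nonTrivial⇒n>1 p))

  ⊆rotations : ∀ {g} → Is⟨ g ∷ [] ⟩ v → rotations g ≡ true → ¬ v ∋ srpow 0
  ⊆rotations v≡⟨g⟩ g∈ = generated⊆ {v = v} v≡⟨g⟩ rotations-isSubgroup λ { _ (here refl) → ≡true⇒T g∈ }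

  ecc≡2 : InH1p v ⊎ (∃[ i ] (1 ≤ i × i ≤ p × IsHp i v)) → Ecc v 2
  ecc≡2 (inj₁ (inj₁ v≡⟨r⟩)) =
    ∋rᵈ⇒ecc≡2 v 0 (generated∈ {v = v} v≡⟨r⟩ λ _ K≤G gens⊆K → rpow∈ K≤G (gens⊆K _ (here refl)) p)
                  (⊆rotations v≡⟨r⟩ refl)
  ecc≡2 (inj₁ (inj₂ v≡⟨rᵖ⟩)) =
    ∋rᵈ⇒ecc≡2 v 0 (generator∈ {v = v} v≡⟨rᵖ⟩ (here refl)) (⊆rotations v≡⟨rᵖ⟩ refl)
  ecc≡2 (inj₂ (i , _ , _ , v≡Hᵢ)) =
    ∋rᵈ⇒ecc≡2 v (suc i) (generator∈ {v = v} v≡Hᵢ (here refl))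
      (srpow-suc∉residue i ∘ T⇒≡true ∘ generated⊆ {v = v} v≡Hᵢ (residue-isSubgroup i) λ
        { _ (here refl)         → ≡true⇒T (rpow-d∈residue i)
        ; _ (there (here refl)) → ≡true⇒T (srpow∈residue i) })

  ecc≡3 : ∃[ i ] (1 ≤ i × i ≤ p × InH i v) → Ecc v 3
  ecc≡3 (_ , _ , _ , _ , _ , _ , v≡⟨srᵏ⟩) =
    reflectionOnly⇒ecc≡3 v _ (generator∈ {v = v} v≡⟨srᵏ⟩ (here refl))
                             (⟨srpow⟩-reflectionOnly {v = v} v≡⟨srᵏ⟩)
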